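{- Let $k\ge 2$ be an integer and let $F$ be a field with more than $k$ elements, whose characteristic does not divide $k$, such that every element of $F$ can be written as a finite sum of $k$th powers of elements of $F$. Then for every positive integer $n$, every polynomial $P\in F[x_1,\ldots,x_n]$ is a finite sum of $k$th powers of polynomials in $F[x_1,\ldots,x_n]$; that is, $F[x_1,\ldots,x_n]=W(F[x_1,\ldots,x_n],k)$.
   Context: For a domain $A$ and integer $k\ge2$, $W(A,k)$ denotes the set of all finite sums of $k$th powers $a^k$ with $a\in A$. -}

module Defs where

open import Level using (Level; _⊔_; Lift) renaming (suc to lsuc)
open import Data.Nat using (ℕ; zero; suc)
open import Data.List using (List; []; _∷_; map; foldr; length)
open import Data.List.Relation.Unary.All using (All)
open import Data.List.Relation.Unary.AllPairs using (AllPairs)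
open import Data.Product using (Σ; _×_; ∃)
open import Relation.Binary.PropositionalEquality using (_≡_)
open import Relation.Nullary using (¬_)
open import Algebra.Bundles using (CommutativeRing)
open import Algebra.Bundles.Raw using (RawRing)

module _ {c ℓ : Level} (R : RawRing c ℓ) where
  open RawRing R

  pow : Carrier → ℕ → Carrier
  pow a zero    = 1#
  pow a (suc k) = a * pow a k

  sumR : List Carrier → Carrier
  sumR = foldr _+_ 0#

  mult1 : ℕ → Carrier
  mult1 zero    = 0#
  mult1 (suc k) = 1# + mult1 k

  InW : ℕ → Carrier → Set (c ⊔ ℓ)
  InW k x = Σ (List Carrier) λ as → sumR (map (λ a → pow a k) as) ≈ x

  MoreThan : ℕ → Set (c ⊔ ℓ)
  MoreThan k = Σ (List Carrier) λ as →
    (length as ≡ suc k) × AllPairs (λ a b → ¬ (a ≈ b)) as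

record Field (c ℓ : Level) : Set (lsuc (c ⊔ ℓ)) where
  field
    commutativeRing : CommutativeRing c ℓ
  open CommutativeRing commutativeRing public
  field
    1≉0     : ¬ (1# ≈ 0#)
    inverse : ∀ x → ¬ (x ≈ 0#) → ∃ λ y → x * y ≈ 1#

-- The polynomial ring F[x₁,…,xₙ], built as iterated univariate polynomial
-- rings:  Poly 0 = F,  Poly (n+1) = (Poly n)[x_{n+1}], an element of the
-- latter being its list of coefficients (lowest degree first).  Equality
-- is coefficientwise equality up to trailing zero coefficients.

module Polynomials {c ℓ : Level} (F : Field c ℓ) where
  open Field F renaming (Carrier to K)

  Poly : ℕ → Set c
  Poly zero    = K
  Poly (suc n) = List (Poly n)

  IsZero : ∀ n → Poly n → Set (c ⊔ ℓ)
  IsZero zero    a  = Lift c (a ≈ 0#)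
  IsZero (suc n) ps = All (IsZero n) ps

  Eq : ∀ n → Poly n → Poly n → Set (c ⊔ ℓ)
  EqL : ∀ n → List (Poly n) → List (Poly n) → Set (c ⊔ ℓ)
  Eq zero    a b = Lift c (a ≈ b)
  Eq (suc n) p q = EqL n p q
  EqL n []       qs       = All (IsZero n) qs
  EqL n (p ∷ ps) []       = All (IsZero n) (p ∷ ps)
  EqL n (p ∷ ps) (q ∷ qs) = Eq n p q × EqL n ps qs

  zeroP : ∀ n → Poly n
  zeroP zero    = 0#
  zeroP (suc n) = []

  oneP : ∀ n → Poly n
  oneP zero    = 1#
  oneP (suc n) = oneP n ∷ []

  addP : ∀ n → Poly n → Poly n → Poly n
  addL : ∀ n → List (Poly n) → List (Poly n) → List (Poly n)
  addP zero    a b = a + b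
  addP (suc n) p q = addL n p q
  addL n []       qs       = qs
  addL n (p ∷ ps) []       = p ∷ ps
  addL n (p ∷ ps) (q ∷ qs) = addP n p q ∷ addL n ps qs

  negP : ∀ n → Poly n → Poly n
  negP zero    a = - a
  negP (suc n) p = map (negP n) p

  mulP : ∀ n → Poly n → Poly n → Poly n
  mulL : ∀ n → List (Poly n) → List (Poly n) → List (Poly n)
  mulP zero    a b = a * b
  mulP (suc n) p q = mulL n p q
  -- (p + x·ps)·q = p·q + x·(ps·q)
  mulL n []       qs = []
  mulL n (p ∷ ps) qs = addL n (map (mulP n p) qs) (zeroP n ∷ mulL n ps qs)

  PolyRing : ℕ → RawRing c (c ⊔ ℓ)
  PolyRing n = record
    { Carrier = Poly n
    ; _≈_     = Eq n
    ; _+_     = addP n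
    ; _*_     = mulP n
    ; -_      = negP n
    ; 0#      = zeroP n
    ; 1#      = oneP n
    }

-- The argument works in any commutative F-algebra R.  Fix distinct
-- a₁,…,a_k ∈ F and x ∈ R, and consider the nodes bᵢ = x + aᵢ.  Their
-- divided-difference weights wᵢ = 1 / ∏_{j≠i} (aᵢ − aⱼ) are constants and
-- satisfy Σ wᵢ bᵢ^(k−1) = 1, Σ wᵢ bᵢ^k = Σ bᵢ, so
--     Σ wᵢ (x + aᵢ)^k = k·x + Σ aᵢ,
-- and x = (k·1)⁻¹ (Σ wᵢ (x + aᵢ)^k − Σ aᵢ).  Constants are sums of k-th
-- powers by hypothesis, and sums of k-th powers are closed under sums and
-- products, hence x is a sum of k-th powers.
module Submission where

open import Level using (_⊔_; lift; lower)
open import Data.Nat using (ℕ; zero; suc; _≤_; _<_; s≤s)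
open import Data.Nat.Properties using (suc-injective; m<n⇒m<1+n; n<1+n)
open import Data.List using (List; []; _∷_; map; length; _++_)
open import Data.List.Properties using (map-++)
open import Data.List.Relation.Unary.All as All using (All; []; _∷_)
open import Data.List.Relation.Unary.All.Properties using (map⁺)
open import Data.List.Relation.Unary.AllPairs using (AllPairs; _∷_)
open import Data.Product using (Σ; _×_; _,_)
open import Relation.Binary.PropositionalEquality as ≡ using (_≡_)
open import Relation.Nullary using (¬_)
open import Algebra.Bundles using (CommutativeRing)
open import Algebra.Structures using (IsCommutativeRing)
open import Algebra.Morphism.Structures using (module RingMorphisms)
open import Defs

open RingMorphisms using (IsRingHomomorphism)

module SumsOfPowers {c ℓ} (R : CommutativeRing c ℓ) where
  open CommutativeRing R
  open import Relation.Binary.Reasoning.Setoid setoid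
  open import Algebra.Solver.Ring.NaturalCoefficients.Default commutativeSemiring

  infixr 8 _^_
  _^_ : Carrier → ℕ → Carrier
  _^_ = pow rawRing

  sum : List Carrier → Carrier
  sum = sumR rawRing

  W : ℕ → Carrier → Set (c ⊔ ℓ)
  W = InW rawRing

  ^-distrib-* : ∀ u v k → (u * v) ^ k ≈ u ^ k * v ^ k
  ^-distrib-* u v zero    = sym (*-identityˡ 1#)
  ^-distrib-* u v (suc k) = begin
    (u * v) * (u * v) ^ k       ≈⟨ *-congˡ (^-distrib-* u v k) ⟩
    (u * v) * (u ^ k * v ^ k)   ≈⟨ solve 4 (λ u v U V → (u :* v) :* (U :* V) := (u :* U) :* (v :* V))
                                     refl u v (u ^ k) (v ^ k) ⟩
    (u * u ^ k) * (v * v ^ k)   ∎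

  sum-++ : ∀ xs ys → sum (xs ++ ys) ≈ sum xs + sum ys
  sum-++ []       ys = sym (+-identityˡ _)
  sum-++ (x ∷ xs) ys = trans (+-congˡ (sum-++ xs ys)) (sym (+-assoc _ _ _))

  module _ (k : ℕ) where
    powers : List Carrier → List Carrier
    powers = map (_^ k)

    W-cong : ∀ {x y} → x ≈ y → W k x → W k y
    W-cong x≈y (as , Σas≈x) = as , trans Σas≈x x≈y

    W-0 : W k 0#
    W-0 = [] , refl

    W-pow : ∀ y → W k (y ^ k)
    W-pow y = y ∷ [] , +-identityʳ _

    W-+ : ∀ {x y} → W k x → W k y → W k (x + y)
    W-+ (as , Σas≈x) (bs , Σbs≈y) = as ++ bs , (begin
      sum (powers (as ++ bs))            ≡⟨ ≡.cong sum (map-++ (_^ k) as bs) ⟩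
      sum (powers as ++ powers bs)       ≈⟨ sum-++ (powers as) (powers bs) ⟩
      sum (powers as) + sum (powers bs)  ≈⟨ +-cong Σas≈x Σbs≈y ⟩
      _                                  ∎)

    sum-powers-scaled : ∀ a bs → sum (powers (map (a *_) bs)) ≈ a ^ k * sum (powers bs)
    sum-powers-scaled a []       = sym (zeroʳ _)
    sum-powers-scaled a (b ∷ bs) = begin
      (a * b) ^ k + sum (powers (map (a *_) bs))  ≈⟨ +-cong (^-distrib-* a b k) (sum-powers-scaled a bs) ⟩
      a ^ k * b ^ k + a ^ k * sum (powers bs)     ≈⟨ sym (distribˡ _ _ _) ⟩
      a ^ k * (b ^ k + sum (powers bs))           ∎

    W-pow-* : ∀ a {y} → W k y → W k (a ^ k * y)
    W-pow-* a (bs , Σbs≈y) = map (a *_) bs , trans (sum-powers-scaled a bs) (*-congˡ Σbs≈y)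

    W-* : ∀ {x y} → W k x → W k y → W k (x * y)
    W-* {y = y} (as , Σas≈x) Wy = W-cong (*-congʳ Σas≈x) (W-sum-* as)
      where
      W-sum-* : ∀ as → W k (sum (powers as) * y)
      W-sum-* []       = W-cong (sym (zeroˡ y)) W-0
      W-sum-* (a ∷ as) = W-cong (sym (distribʳ y _ _)) (W-+ (W-pow-* a Wy) (W-sum-* as))

module Homomorphisms {c₁ ℓ₁ c₂ ℓ₂} (A : CommutativeRing c₁ ℓ₁) (B : CommutativeRing c₂ ℓ₂)
  (φ : CommutativeRing.Carrier A → CommutativeRing.Carrier B)
  (φ-hom : IsRingHomomorphism (CommutativeRing.rawRing A) (CommutativeRing.rawRing B) φ) where

  private
    module A where
      open CommutativeRing A public
      open SumsOfPowers A public
  open CommutativeRing B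
  open SumsOfPowers B
  open IsRingHomomorphism φ-hom

  φ-pow : ∀ a k → φ (a A.^ k) ≈ φ a ^ k
  φ-pow a zero    = 1#-homo
  φ-pow a (suc k) = trans (*-homo a (a A.^ k)) (*-congˡ (φ-pow a k))

  φ-sum : ∀ as → φ (A.sum as) ≈ sum (map φ as)
  φ-sum []       = 0#-homo
  φ-sum (a ∷ as) = trans (+-homo a (A.sum as)) (+-congˡ (φ-sum as))

  φ-sum-powers : ∀ k as → φ (A.sum (A.powers k as)) ≈ sum (powers k (map φ as))
  φ-sum-powers k []       = 0#-homo
  φ-sum-powers k (a ∷ as) =
    trans (+-homo (a A.^ k) _) (+-cong (φ-pow a k) (φ-sum-powers k as))

  W-map : ∀ {k a} → A.W k a → W k (φ a)
  W-map {k} (as , Σas≈a) = map φ as , trans (sym (φ-sum-powers k as)) (⟦⟧-cong Σas≈a)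

-- For nodes b₀,…,b_m of a commutative ring,
-- weights w₀,…,w_m (the coefficients of f ↦ f[b₀,…,b_m]) satisfy
--   Σ wᵢ bᵢ^e = 0 for e < m,   Σ wᵢ bᵢ^m = 1,   Σ wᵢ bᵢ^(m+1) = Σ bᵢ.
-- They are built by recursion on the nodes: if m₁,…,m_m are weights for
-- b₁,…,b_m, then wᵢ = mᵢ / (bᵢ − b₀) for i ≥ 1 and w₀ = −Σ_{i≥1} wᵢ.
module DividedDifferences {c ℓ} (R : CommutativeRing c ℓ) where
  open CommutativeRing R
  open SumsOfPowers R using (_^_; sum)
  open import Relation.Binary.Reasoning.Setoid setoid
  open import Algebra.Solver.Ring.NaturalCoefficients.Default commutativeSemiring

  moment : List Carrier → List Carrier → ℕ → Carrier
  moment []       _        e = 0#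
  moment (b ∷ bs) []       e = 0#
  moment (b ∷ bs) (w ∷ ws) e = w * b ^ e + moment bs ws e

  data Quotients (b₀ : Carrier) : List Carrier → List Carrier → List Carrier → Set (c ⊔ ℓ) where
    []  : Quotients b₀ [] [] []
    _∷_ : ∀ {b w m bs ws ms} → w * (b + - b₀) ≈ m →
          Quotients b₀ bs ws ms → Quotients b₀ (b ∷ bs) (w ∷ ws) (m ∷ ms)

  record DDWeights (bs ws : List Carrier) (m : ℕ) : Set ℓ where
    field
      below : ∀ e → e < m → moment bs ws e ≈ 0#
      top   : moment bs ws m ≈ 1#
      next  : moment bs ws (suc m) ≈ sum bs

  quotient-shift : ∀ {b₀ b w m} → w * (b + - b₀) ≈ m → ∀ p → w * (b * p) ≈ b₀ * (w * p) + m * p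
  quotient-shift {b₀} {b} {w} {m} w[b-b₀]≈m p = begin
    w * (b * p)                        ≈⟨ *-congˡ (*-congʳ b≈[b-b₀]+b₀) ⟩
    w * (((b + - b₀) + b₀) * p)        ≈⟨ solve 4 (λ w d b₀ p → w :* ((d :+ b₀) :* p) := b₀ :* (w :* p) :+ (w :* d) :* p)
                                            refl w (b + - b₀) b₀ p ⟩
    b₀ * (w * p) + (w * (b + - b₀)) * p ≈⟨ +-congˡ (*-congʳ w[b-b₀]≈m) ⟩
    b₀ * (w * p) + m * p               ∎
    where
    b≈[b-b₀]+b₀ : b ≈ (b + - b₀) + b₀
    b≈[b-b₀]+b₀ = sym (trans (+-assoc b (- b₀) b₀) (trans (+-congˡ (-‿inverseˡ b₀)) (+-identityʳ b)))

  moment-suc : ∀ {b₀ bs ws ms} → Quotients b₀ bs ws ms → ∀ e →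
               moment bs ws (suc e) ≈ b₀ * moment bs ws e + moment bs ms e
  moment-suc {b₀} [] e = sym (trans (+-identityʳ _) (zeroʳ b₀))
  moment-suc {b₀} (_∷_ {b} {w} {m} {bs} {ws} {ms} q qs) e = begin
    w * (b * b ^ e) + moment bs ws (suc e)
      ≈⟨ +-cong (quotient-shift q (b ^ e)) (moment-suc qs e) ⟩
    (b₀ * (w * b ^ e) + m * b ^ e) + (b₀ * moment bs ws e + moment bs ms e)
      ≈⟨ solve 5 (λ b₀ u v s t → (b₀ :* u :+ v) :+ (b₀ :* s :+ t) := b₀ :* (u :+ s) :+ (v :+ t))
           refl b₀ (w * b ^ e) (m * b ^ e) (moment bs ws e) (moment bs ms e) ⟩
    b₀ * (w * b ^ e + moment bs ws e) + (m * b ^ e + moment bs ms e) ∎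

  moment-zero : ∀ {b₀ bs ws ms} → Quotients b₀ bs ws ms → moment bs ws 0 ≈ sum ws
  moment-zero []       = refl
  moment-zero (_ ∷ qs) = +-cong (*-identityʳ _) (moment-zero qs)

  dd-single : ∀ {b w} → w ≈ 1# → DDWeights (b ∷ []) (w ∷ []) 0
  dd-single {b} {w} w≈1 = record
    { below = λ _ ()
    ; top   = trans (+-identityʳ _) (trans (*-identityʳ w) w≈1)
    ; next  = trans (+-identityʳ _) (trans (*-cong w≈1 (*-identityʳ b)) (trans (*-identityˡ b) (sym (+-identityʳ b))))
    }

  dd-cons : ∀ {b₀ w₀ bs ws ms m} → DDWeights bs ms m → Quotients b₀ bs ws ms →
            w₀ + sum ws ≈ 0# → DDWeights (b₀ ∷ bs) (w₀ ∷ ws) (suc m)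
  dd-cons {b₀} {w₀} {bs} {ws} {ms} {m} dd qs Σw≈0 = record { below = below ; top = top ; next = next }
    where
    module dd = DDWeights dd
    T : ℕ → Carrier
    T = moment (b₀ ∷ bs) (w₀ ∷ ws)

    T-suc : ∀ e → T (suc e) ≈ b₀ * T e + moment bs ms e
    T-suc e = begin
      w₀ * (b₀ * b₀ ^ e) + moment bs ws (suc e)
        ≈⟨ +-congˡ (moment-suc qs e) ⟩
      w₀ * (b₀ * b₀ ^ e) + (b₀ * moment bs ws e + moment bs ms e)
        ≈⟨ solve 5 (λ w₀ b₀ p s t → w₀ :* (b₀ :* p) :+ (b₀ :* s :+ t) := b₀ :* (w₀ :* p :+ s) :+ t)
             refl w₀ b₀ (b₀ ^ e) (moment bs ws e) (moment bs ms e) ⟩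
      b₀ * T e + moment bs ms e ∎

    vanishing-term : ∀ {t} s → t ≈ 0# → b₀ * t + s ≈ s
    vanishing-term s t≈0 = trans (+-congʳ (trans (*-congˡ t≈0) (zeroʳ b₀))) (+-identityˡ s)

    below : ∀ e → e < suc m → T e ≈ 0#
    below zero    _         = trans (+-cong (*-identityʳ w₀) (moment-zero qs)) Σw≈0
    below (suc e) (s≤s e<m) =
      trans (T-suc e) (trans (vanishing-term _ (below e (m<n⇒m<1+n e<m))) (dd.below e e<m))

    top : T (suc m) ≈ 1#
    top = trans (T-suc m) (trans (vanishing-term _ (below m (n<1+n m))) dd.top)

    next : T (suc (suc m)) ≈ b₀ + sum bs
    next = trans (T-suc (suc m)) (+-cong (trans (*-congˡ top) (*-identityʳ b₀)) dd.next)

-- Writing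
-- node x a = x + ι a, the divided-difference weights of the nodes
-- x + ι aᵢ are constants ι wᵢ, and Σ ι wᵢ (x + ι aᵢ)^k = k·x + ι(Σ aᵢ).
module FieldAlgebras {c ℓ c′ ℓ′} (F : Field c ℓ) (R : CommutativeRing c′ ℓ′)
  (ι : Field.Carrier F → CommutativeRing.Carrier R)
  (ι-hom : IsRingHomomorphism (Field.rawRing F) (CommutativeRing.rawRing R) ι) where

  private
    module F where
      open Field F public
      open SumsOfPowers commutativeRing public
      open import Algebra.Properties.Group +-group public using (x∙y⁻¹≈ε⇒x≈y)
  open CommutativeRing R
  open SumsOfPowers R
  open DividedDifferences R
  open IsRingHomomorphism ι-hom
  open Homomorphisms F.commutativeRing R ι ι-hom using (φ-sum; W-map)
  open import Relation.Binary.Reasoning.Setoid setoid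
  open import Algebra.Solver.Ring.NaturalCoefficients.Default commutativeSemiring
  open import Algebra.Properties.AbelianGroup +-abelianGroup using (⁻¹-∙-comm)

  node : Carrier → F.Carrier → Carrier
  node x a = x + ι a

  node-difference : ∀ x a a₀ → node x a + - node x a₀ ≈ ι (a F.+ F.- a₀)
  node-difference x a a₀ = begin
    (x + ι a) + - (x + ι a₀)        ≈⟨ +-congˡ (sym (⁻¹-∙-comm x (ι a₀))) ⟩
    (x + ι a) + (- x + - ι a₀)      ≈⟨ solve 4 (λ x p x′ q′ → (x :+ p) :+ (x′ :+ q′) := (x :+ x′) :+ (p :+ q′))
                                          refl x (ι a) (- x) (- ι a₀) ⟩
    (x + - x) + (ι a + - ι a₀)      ≈⟨ trans (+-congʳ (-‿inverseʳ x)) (+-identityˡ _) ⟩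
    ι a + - ι a₀                    ≈⟨ +-congˡ (sym (-‿homo a₀)) ⟩
    ι a + ι (F.- a₀)                ≈⟨ sym (+-homo a (F.- a₀)) ⟩
    ι (a F.+ F.- a₀)                ∎

  quotient-weights : ∀ a₀ as ms → All (λ a → ¬ (a₀ F.≈ a)) as → length as ≡ length ms →
    Σ (List F.Carrier) λ ws → length ws ≡ length as ×
      ∀ x → Quotients (node x a₀) (map (node x) as) (map ι ws) (map ι ms)
  quotient-weights a₀ []       []       []         _   = [] , ≡.refl , λ _ → []
  quotient-weights a₀ (a ∷ as) (m ∷ ms) (a₀≉a ∷ ds) len
    with F.inverse (a F.+ F.- a₀) (λ d≈0 → a₀≉a (F.sym (F.x∙y⁻¹≈ε⇒x≈y a a₀ d≈0)))
       | quotient-weights a₀ as ms ds (suc-injective len)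
  ... | y , dy≈1 | ws , len-ws , qs = m F.* y ∷ ws , ≡.cong suc len-ws , λ x → quotient x ∷ qs x
    where
    quotient : ∀ x → ι (m F.* y) * (node x a + - node x a₀) ≈ ι m
    quotient x = begin
      ι (m F.* y) * (node x a + - node x a₀)     ≈⟨ *-congˡ (node-difference x a a₀) ⟩
      ι (m F.* y) * ι (a F.+ F.- a₀)            ≈⟨ sym (*-homo _ _) ⟩
      ι ((m F.* y) F.* (a F.+ F.- a₀))          ≈⟨ ⟦⟧-cong (F.trans (F.*-assoc m y _) (F.*-congˡ (F.trans (F.*-comm y _) dy≈1))) ⟩
      ι (m F.* F.1#)                            ≈⟨ ⟦⟧-cong (F.*-identityʳ m) ⟩
      ι m                                       ∎

  dd-weights : ∀ a₀ as → AllPairs (λ a b → ¬ (a F.≈ b)) (a₀ ∷ as) →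
    Σ (List F.Carrier) λ ws → length ws ≡ suc (length as) ×
      ∀ x → DDWeights (map (node x) (a₀ ∷ as)) (map ι ws) (length as)
  dd-weights a₀ []         _                  = F.1# ∷ [] , ≡.refl , λ _ → dd-single 1#-homo
  dd-weights a₀ (a₁ ∷ as) (a₀≉as ∷ distinct) with dd-weights a₁ as distinct
  ... | ms , len-ms , dd with quotient-weights a₀ (a₁ ∷ as) ms a₀≉as (≡.sym len-ms)
  ...   | ws , len-ws , qs = F.- F.sum ws ∷ ws , ≡.cong suc len-ws , λ x → dd-cons (dd x) (qs x) Σw≈0
    where
    Σw≈0 : ι (F.- F.sum ws) + sum (map ι ws) ≈ 0#
    Σw≈0 = trans (+-cong (-‿homo _) (sym (φ-sum ws))) (-‿inverseˡ _)

  sum-nodes : ∀ x as → sum (map (node x) as) ≈ ι (mult1 F.rawRing (length as)) * x + ι (F.sum as)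
  sum-nodes x []       = sym (trans (+-cong (trans (*-congʳ 0#-homo) (zeroˡ x)) 0#-homo) (+-identityʳ 0#))
  sum-nodes x (a ∷ as) = begin
    (x + ι a) + sum (map (node x) as)    ≈⟨ +-congˡ (sum-nodes x as) ⟩
    (x + ι a) + (ι M * x + ι A)          ≈⟨ solve 4 (λ x a M A → (x :+ a) :+ (M :* x :+ A) := (con 1 :+ M) :* x :+ (a :+ A))
                                              refl x (ι a) (ι M) (ι A) ⟩
    (1# + ι M) * x + (ι a + ι A)         ≈⟨ +-cong (*-congʳ (trans (+-congʳ (sym 1#-homo)) (sym (+-homo F.1# M)))) (sym (+-homo a A)) ⟩
    ι (F.1# F.+ M) * x + ι (a F.+ A)     ∎
    where
    M = mult1 F.rawRing (length as)
    A = F.sum as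

  solve-linear : ∀ {u n} x a → u * n ≈ 1# → u * (n * x + a) + - (u * a) ≈ x
  solve-linear {u} {n} x a un≈1 = begin
    u * (n * x + a) + - (u * a)       ≈⟨ solve 5 (λ u n x a v → u :* (n :* x :+ a) :+ v := (u :* n) :* x :+ (u :* a :+ v))
                                           refl u n x a (- (u * a)) ⟩
    (u * n) * x + (u * a + - (u * a)) ≈⟨ +-cong (*-congʳ un≈1) (-‿inverseʳ _) ⟩
    1# * x + 0#                       ≈⟨ trans (+-identityʳ _) (*-identityˡ x) ⟩
    x                                 ∎

  W-moment : ∀ k bs {ws} → All (W k) ws → W k (moment bs ws k)
  W-moment k []       _          = W-0 k
  W-moment k (b ∷ bs) []         = W-0 k
  W-moment k (b ∷ bs) (Ww ∷ Wws) = W-+ k (W-* k Ww (W-pow k b)) (W-moment k bs Wws)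

  every-element-is-a-sum-of-powers : ∀ k a₀ as → AllPairs (λ a b → ¬ (a F.≈ b)) (a₀ ∷ as) →
    length (a₀ ∷ as) ≡ k → ¬ (mult1 F.rawRing k F.≈ F.0#) → (∀ a → F.W k a) → ∀ x → W k x
  every-element-is-a-sum-of-powers k a₀ as distinct ≡.refl k≉0 F-powers x
    with dd-weights a₀ as distinct | F.inverse (mult1 F.rawRing k) k≉0
  ... | ws , _ , dd | κ , kκ≈1 =
    W-cong k x≈combination
      (W-+ k (W-* k (W-const κ) (W-moment k bs (map⁺ (All.universal W-const ws)))) (W-const _))
    where
    W-const : ∀ a → W k (ι a)
    W-const a = W-map {k} (F-powers a)
    bs = map (node x) (a₀ ∷ as)
    A = F.sum (a₀ ∷ as)
    x≈combination : ι κ * moment bs (map ι ws) k + ι (F.- (κ F.* A)) ≈ x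
    x≈combination = begin
      ι κ * moment bs (map ι ws) k + ι (F.- (κ F.* A))
        ≈⟨ +-cong (*-congˡ (trans (DDWeights.next (dd x)) (sum-nodes x (a₀ ∷ as))))
                  (trans (-‿homo _) (-‿cong (*-homo κ A))) ⟩
      ι κ * (ι (mult1 F.rawRing k) * x + ι A) + - (ι κ * ι A)
        ≈⟨ solve-linear x (ι A) (trans (sym (*-homo κ _)) (trans (⟦⟧-cong (F.trans (F.*-comm κ _) kκ≈1)) 1#-homo)) ⟩
      x ∎

-- An element of Poly (n+1) is a list of
-- coefficients in Poly n, compared up to trailing zeros, so the ring laws
-- of Poly (n+1) follow from those of Poly n by recursion on lists.
module PolynomialRing {c ℓ} (F : Field c ℓ) where
  open Polynomials F
  private module F = Field F

  isZero⇒≈0 : ∀ n p → IsZero n p → Eq n p (zeroP n)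
  isZero⇒≈0 zero    p        z = z
  isZero⇒≈0 (suc n) []       z = z
  isZero⇒≈0 (suc n) (p ∷ ps) z = z

  ≈0⇒isZero : ∀ n p → Eq n p (zeroP n) → IsZero n p
  ≈0⇒isZero zero    p        z = z
  ≈0⇒isZero (suc n) []       z = z
  ≈0⇒isZero (suc n) (p ∷ ps) z = z

  module CoefficientLists (n : ℕ)
    (isCR : IsCommutativeRing (Eq n) (addP n) (mulP n) (negP n) (zeroP n) (oneP n)) where

    open IsCommutativeRing isCR

    infix  4 _≈_ _≋_
    infixl 6 _⊕_ _+_
    infixl 7 _⊗_ _*_

    _≈_ : Poly n → Poly n → Set (c ⊔ ℓ)
    _≈_ = Eq n

    _+_ _*_ : Poly n → Poly n → Poly n
    _+_ = addP n
    _*_ = mulP n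

    0p : Poly n
    0p = zeroP n

    Z : Poly n → Set (c ⊔ ℓ)
    Z = IsZero n

    Zs : List (Poly n) → Set (c ⊔ ℓ)
    Zs = All Z

    _≋_ : List (Poly n) → List (Poly n) → Set (c ⊔ ℓ)
    _≋_ = EqL n

    _⊕_ _⊗_ : List (Poly n) → List (Poly n) → List (Poly n)
    _⊕_ = addL n
    _⊗_ = mulL n

    Z-cong : ∀ {p q} → Z p → p ≈ q → Z q
    Z-cong {p} {q} z e = ≈0⇒isZero n q (trans (sym e) (isZero⇒≈0 n p z))

    Z-0 : Z 0p
    Z-0 = ≈0⇒isZero n 0p refl

    ≋-refl : ∀ ps → ps ≋ ps
    ≋-refl [] = []
    ≋-refl (p ∷ ps) = refl , ≋-refl ps

    ≋-sym : ∀ {ps qs} → ps ≋ qs → qs ≋ ps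
    ≋-sym {[]} {[]} e = e
    ≋-sym {[]} {q ∷ qs} e = e
    ≋-sym {p ∷ ps} {[]} e = e
    ≋-sym {p ∷ ps} {q ∷ qs} (e , r) = sym e , ≋-sym r

    zeros-eq : ∀ {ps qs} → Zs ps → Zs qs → ps ≋ qs
    zeros-eq {[]} zp zq = zq
    zeros-eq {p ∷ ps} {[]} zp zq = zp
    zeros-eq {p ∷ ps} {q ∷ qs} (zp ∷ zps) (zq ∷ zqs) =
      trans (isZero⇒≈0 n p zp) (sym (isZero⇒≈0 n q zq)) , zeros-eq zps zqs

    eq-zeros : ∀ {ps qs} → ps ≋ qs → Zs ps → Zs qs
    eq-zeros {[]} e _ = e
    eq-zeros {p ∷ ps} {[]} _ _ = []
    eq-zeros {p ∷ ps} {q ∷ qs} (e , r) (zp ∷ zps) = Z-cong zp e ∷ eq-zeros r zps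

    ≋-trans : ∀ {ps qs rs} → ps ≋ qs → qs ≋ rs → ps ≋ rs
    ≋-trans {[]} e1 e2 = eq-zeros e2 e1
    ≋-trans {p ∷ ps} {[]} e1 e2 = zeros-eq e1 e2
    ≋-trans {p ∷ ps} {q ∷ qs} {[]} e1 e2 = eq-zeros (≋-sym e1) e2
    ≋-trans {p ∷ ps} {q ∷ qs} {r ∷ rs} (e1 , r1) (e2 , r2) = trans e1 e2 , ≋-trans r1 r2

    zeros-left : ∀ {ps} qs → Zs ps → (ps ⊕ qs) ≋ qs
    zeros-left {[]} qs _ = ≋-refl qs
    zeros-left {p ∷ ps} [] z = z
    zeros-left {p ∷ ps} (q ∷ qs) (zp ∷ zps) =
      trans (+-congʳ (isZero⇒≈0 n p zp)) (+-identityˡ q) , zeros-left qs zps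

    zeros-right : ∀ ps {qs} → Zs qs → (ps ⊕ qs) ≋ ps
    zeros-right [] {[]} z = []
    zeros-right [] {q ∷ qs} z = z
    zeros-right (p ∷ ps) {[]} z = ≋-refl (p ∷ ps)
    zeros-right (p ∷ ps) {q ∷ qs} (zq ∷ zqs) =
      trans (+-congˡ (isZero⇒≈0 n q zq)) (+-identityʳ p) , zeros-right ps zqs

    ⊕-comm : ∀ ps qs → (ps ⊕ qs) ≋ (qs ⊕ ps)
    ⊕-comm [] [] = []
    ⊕-comm [] (q ∷ qs) = ≋-refl (q ∷ qs)
    ⊕-comm (p ∷ ps) [] = ≋-refl (p ∷ ps)
    ⊕-comm (p ∷ ps) (q ∷ qs) = +-comm p q , ⊕-comm ps qs

    ⊕-assoc : ∀ ps qs rs → ((ps ⊕ qs) ⊕ rs) ≋ (ps ⊕ (qs ⊕ rs))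
    ⊕-assoc [] qs rs = ≋-refl (qs ⊕ rs)
    ⊕-assoc (p ∷ ps) [] rs = ≋-refl ((p ∷ ps) ⊕ rs)
    ⊕-assoc (p ∷ ps) (q ∷ qs) [] = ≋-refl (p + q ∷ ps ⊕ qs)
    ⊕-assoc (p ∷ ps) (q ∷ qs) (r ∷ rs) = +-assoc p q r , ⊕-assoc ps qs rs

    ⊕-cong : ∀ {ps ps' qs qs'} → ps ≋ ps' → qs ≋ qs' → (ps ⊕ qs) ≋ (ps' ⊕ qs')
    ⊕-cong {[]} {ps'} {qs} {qs'} e1 e2 = ≋-trans e2 (≋-sym (zeros-left qs' e1))
    ⊕-cong {p ∷ ps} {[]} {qs} e1 e2 = ≋-trans (zeros-left qs e1) e2
    ⊕-cong {p ∷ ps} {p' ∷ ps'} {[]} {qs'} e1 e2 = ≋-trans e1 (≋-sym (zeros-right (p' ∷ ps') e2))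
    ⊕-cong {p ∷ ps} {p' ∷ ps'} {q ∷ qs} {[]} e1 e2 = ≋-trans (zeros-right (p ∷ ps) e2) e1
    ⊕-cong {p ∷ ps} {p' ∷ ps'} {q ∷ qs} {q' ∷ qs'} (e1 , r1) (e2 , r2) = +-cong e1 e2 , ⊕-cong r1 r2

    ⊕-congˡ : ∀ ps {qs qs'} → qs ≋ qs' → (ps ⊕ qs) ≋ (ps ⊕ qs')
    ⊕-congˡ ps e = ⊕-cong (≋-refl ps) e
    ⊕-congʳ : ∀ {ps ps'} qs → ps ≋ ps' → (ps ⊕ qs) ≋ (ps' ⊕ qs)
    ⊕-congʳ qs e = ⊕-cong e (≋-refl qs)

    ⊕-leftcomm : ∀ a b c → (a ⊕ (b ⊕ c)) ≋ (b ⊕ (a ⊕ c))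
    ⊕-leftcomm a b c = ≋-trans (≋-sym (⊕-assoc a b c))
      (≋-trans (⊕-congʳ c (⊕-comm a b)) (⊕-assoc b a c))

    ⊕-interchange : ∀ a b c d → ((a ⊕ b) ⊕ (c ⊕ d)) ≋ ((a ⊕ c) ⊕ (b ⊕ d))
    ⊕-interchange a b c d = ≋-trans (⊕-assoc a b (c ⊕ d))
      (≋-trans (⊕-congˡ a (⊕-leftcomm b c d)) (≋-sym (⊕-assoc a c (b ⊕ d))))

    Zs-⊕ : ∀ {xs ys} → Zs xs → Zs ys → Zs (xs ⊕ ys)
    Zs-⊕ {[]} _ z = z
    Zs-⊕ {x ∷ xs} {[]} z _ = z
    Zs-⊕ {x ∷ xs} {y ∷ ys} (zx ∷ zxs) (zy ∷ zys) =
      ≈0⇒isZero n _ (trans (+-cong (isZero⇒≈0 n x zx) (isZero⇒≈0 n y zy)) (+-identityʳ 0p)) ∷ Zs-⊕ zxs zys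

    neg0 : negP n 0p ≈ 0p
    neg0 = trans (sym (+-identityʳ _)) (-‿inverseˡ 0p)

    Zs-neg : ∀ {xs} → Zs xs → Zs (map (negP n) xs)
    Zs-neg [] = []
    Zs-neg {x ∷ xs} (z ∷ zs) = ≈0⇒isZero n _ (trans (-‿cong (isZero⇒≈0 n x z)) neg0) ∷ Zs-neg zs

    neg-cong : ∀ {ps qs} → ps ≋ qs → map (negP n) ps ≋ map (negP n) qs
    neg-cong {[]} e = Zs-neg e
    neg-cong {p ∷ ps} {[]} e = Zs-neg e
    neg-cong {p ∷ ps} {q ∷ qs} (e , r) = -‿cong e , neg-cong r

    neg-invˡ : ∀ ps → Zs (map (negP n) ps ⊕ ps)
    neg-invˡ [] = []
    neg-invˡ (p ∷ ps) = ≈0⇒isZero n _ (-‿inverseˡ p) ∷ neg-invˡ ps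

    neg-invʳ : ∀ ps → Zs (ps ⊕ map (negP n) ps)
    neg-invʳ [] = []
    neg-invʳ (p ∷ ps) = ≈0⇒isZero n _ (-‿inverseʳ p) ∷ neg-invʳ ps

    scale : Poly n → List (Poly n) → List (Poly n)
    scale p = map (mulP n p)

    scale-congˡ : ∀ {p p'} qs → p ≈ p' → scale p qs ≋ scale p' qs
    scale-congˡ [] e = []
    scale-congˡ (q ∷ qs) e = *-congʳ e , scale-congˡ qs e

    Zs-scale : ∀ p {qs} → Zs qs → Zs (scale p qs)
    Zs-scale p [] = []
    Zs-scale p {q ∷ qs} (z ∷ zs) = ≈0⇒isZero n _ (trans (*-congˡ (isZero⇒≈0 n q z)) (zeroʳ p)) ∷ Zs-scale p zs

    Zs-scale-by-0 : ∀ {p} qs → Z p → Zs (scale p qs)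
    Zs-scale-by-0 [] z = []
    Zs-scale-by-0 {p} (q ∷ qs) z = ≈0⇒isZero n _ (trans (*-congʳ (isZero⇒≈0 n p z)) (zeroˡ q)) ∷ Zs-scale-by-0 qs z

    scale-congʳ : ∀ p {qs qs'} → qs ≋ qs' → scale p qs ≋ scale p qs'
    scale-congʳ p {[]} e = Zs-scale p e
    scale-congʳ p {q ∷ qs} {[]} e = Zs-scale p e
    scale-congʳ p {q ∷ qs} {q' ∷ qs'} (e , r) = *-congˡ e , scale-congʳ p r

    scale-⊕ : ∀ p qs rs → scale p (qs ⊕ rs) ≋ (scale p qs ⊕ scale p rs)
    scale-⊕ p [] rs = ≋-refl (scale p rs)
    scale-⊕ p (q ∷ qs) [] = ≋-refl (scale p (q ∷ qs))
    scale-⊕ p (q ∷ qs) (r ∷ rs) = distribˡ p q r , scale-⊕ p qs rs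

    scale-+ : ∀ p p' qs → scale (p + p') qs ≋ (scale p qs ⊕ scale p' qs)
    scale-+ p p' [] = []
    scale-+ p p' (q ∷ qs) = distribʳ q p p' , scale-+ p p' qs

    scale-scale : ∀ p p' qs → scale p (scale p' qs) ≋ scale (p * p') qs
    scale-scale p p' [] = []
    scale-scale p p' (q ∷ qs) = sym (*-assoc p p' q) , scale-scale p p' qs

    scale-1 : ∀ qs → scale (oneP n) qs ≋ qs
    scale-1 [] = []
    scale-1 (q ∷ qs) = *-identityˡ q , scale-1 qs

    Zs-⊗ˡ : ∀ {ps} qs → Zs ps → Zs (ps ⊗ qs)
    Zs-⊗ˡ {[]} qs _ = []
    Zs-⊗ˡ {p ∷ ps} qs (z ∷ zs) = Zs-⊕ (Zs-scale-by-0 qs z) (Z-0 ∷ Zs-⊗ˡ qs zs)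

    Zs-⊗ʳ : ∀ ps {qs} → Zs qs → Zs (ps ⊗ qs)
    Zs-⊗ʳ [] _ = []
    Zs-⊗ʳ (p ∷ ps) z = Zs-⊕ (Zs-scale p z) (Z-0 ∷ Zs-⊗ʳ ps z)

    ⊗-congʳ : ∀ ps {qs qs'} → qs ≋ qs' → (ps ⊗ qs) ≋ (ps ⊗ qs')
    ⊗-congʳ [] e = []
    ⊗-congʳ (p ∷ ps) e = ⊕-cong (scale-congʳ p e) (refl , ⊗-congʳ ps e)

    ⊗-congˡ : ∀ {ps ps'} qs → ps ≋ ps' → (ps ⊗ qs) ≋ (ps' ⊗ qs)
    ⊗-congˡ {[]} qs e = Zs-⊗ˡ qs e
    ⊗-congˡ {p ∷ ps} {[]} qs e = zeros-eq (Zs-⊗ˡ qs e) []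
    ⊗-congˡ {p ∷ ps} {p' ∷ ps'} qs (e , r) = ⊕-cong (scale-congˡ qs e) (refl , ⊗-congˡ qs r)

    cons0-⊕ : ∀ a b → (0p ∷ (a ⊕ b)) ≋ ((0p ∷ a) ⊕ (0p ∷ b))
    cons0-⊕ a b = sym (+-identityʳ 0p) , ≋-refl (a ⊕ b)

    distʳ : ∀ ps ps' qs → ((ps ⊕ ps') ⊗ qs) ≋ ((ps ⊗ qs) ⊕ (ps' ⊗ qs))
    distʳ [] ps' qs = ≋-refl (ps' ⊗ qs)
    distʳ (p ∷ ps) [] qs = ≋-sym (zeros-right ((p ∷ ps) ⊗ qs) [])
    distʳ (p ∷ ps) (p' ∷ ps') qs =
      ≋-trans (⊕-cong (scale-+ p p' qs) (≋-trans (refl , distʳ ps ps' qs) (cons0-⊕ (ps ⊗ qs) (ps' ⊗ qs))))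
              (⊕-interchange (scale p qs) (scale p' qs) (0p ∷ ps ⊗ qs) (0p ∷ ps' ⊗ qs))

    scaleʳ : Poly n → List (Poly n) → List (Poly n)
    scaleʳ q = map (λ p → p * q)

    shift : ∀ ps q qs → (ps ⊗ (q ∷ qs)) ≋ (scaleʳ q ps ⊕ (0p ∷ ps ⊗ qs))
    shift [] q qs = Z-0 ∷ []
    shift (p ∷ ps) q qs = refl ,
      ≋-trans (⊕-congˡ (scale p qs) (shift ps q qs)) (⊕-leftcomm (scale p qs) (scaleʳ q ps) (0p ∷ ps ⊗ qs))

    scaleˡ≋scaleʳ : ∀ p qs → scale p qs ≋ scaleʳ p qs
    scaleˡ≋scaleʳ p [] = []
    scaleˡ≋scaleʳ p (q ∷ qs) = *-comm p q , scaleˡ≋scaleʳ p qs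

    ⊗-comm : ∀ ps qs → (ps ⊗ qs) ≋ (qs ⊗ ps)
    ⊗-comm [] qs = Zs-⊗ʳ qs []
    ⊗-comm (p ∷ ps) qs = ≋-trans (⊕-cong (scaleˡ≋scaleʳ p qs) (refl , ⊗-comm ps qs)) (≋-sym (shift qs p ps))

    scale-0∷ : ∀ p xs → scale p (0p ∷ xs) ≋ (0p ∷ scale p xs)
    scale-0∷ p xs = zeroʳ p , ≋-refl (scale p xs)

    scale-⊗ : ∀ p qs rs → (scale p qs ⊗ rs) ≋ scale p (qs ⊗ rs)
    scale-⊗ p [] rs = []
    scale-⊗ p (q ∷ qs) rs =
      ≋-trans (⊕-cong (≋-sym (scale-scale p q rs)) (refl , scale-⊗ p qs rs))
        (≋-sym (≋-trans (scale-⊕ p (scale q rs) (0p ∷ qs ⊗ rs)) (⊕-congˡ (scale p (scale q rs)) (scale-0∷ p (qs ⊗ rs)))))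

    ⊗-assoc : ∀ ps qs rs → ((ps ⊗ qs) ⊗ rs) ≋ (ps ⊗ (qs ⊗ rs))
    ⊗-assoc [] qs rs = []
    ⊗-assoc (p ∷ ps) qs rs =
      ≋-trans (distʳ (scale p qs) (0p ∷ ps ⊗ qs) rs)
        (⊕-cong (scale-⊗ p qs rs)
          (≋-trans (zeros-left (0p ∷ (ps ⊗ qs) ⊗ rs) (Zs-scale-by-0 rs Z-0)) (refl , ⊗-assoc ps qs rs)))

    ⊗-identityˡ : ∀ qs → ((oneP n ∷ []) ⊗ qs) ≋ qs
    ⊗-identityˡ qs = ≋-trans (zeros-right (scale (oneP n) qs) (Z-0 ∷ [])) (scale-1 qs)

    distˡ : ∀ ps qs rs → (ps ⊗ (qs ⊕ rs)) ≋ ((ps ⊗ qs) ⊕ (ps ⊗ rs))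
    distˡ ps qs rs = ≋-trans (⊗-comm ps (qs ⊕ rs))
      (≋-trans (distʳ qs rs ps) (⊕-cong (⊗-comm qs ps) (⊗-comm rs ps)))

  isCommutativeRing : ∀ n → IsCommutativeRing (Eq n) (addP n) (mulP n) (negP n) (zeroP n) (oneP n)
  isCommutativeRing zero = record
    { isRing = record
      { +-isAbelianGroup = record
        { isGroup = record
          { isMonoid = record
            { isSemigroup = record
              { isMagma = record
                { isEquivalence = record
                  { refl  = lift F.refl
                  ; sym   = λ e → lift (F.sym (lower e))
                  ; trans = λ e₁ e₂ → lift (F.trans (lower e₁) (lower e₂)) }
                ; ∙-cong = λ e₁ e₂ → lift (F.+-cong (lower e₁) (lower e₂)) }
              ; assoc = λ x y z → lift (F.+-assoc x y z) }
            ; identity = (λ x → lift (F.+-identityˡ x)) , (λ x → lift (F.+-identityʳ x)) }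
          ; inverse = (λ x → lift (F.-‿inverseˡ x)) , (λ x → lift (F.-‿inverseʳ x))
          ; ⁻¹-cong = λ e → lift (F.-‿cong (lower e)) }
        ; comm = λ x y → lift (F.+-comm x y) }
      ; *-cong     = λ e₁ e₂ → lift (F.*-cong (lower e₁) (lower e₂))
      ; *-assoc    = λ x y z → lift (F.*-assoc x y z)
      ; *-identity = (λ x → lift (F.*-identityˡ x)) , (λ x → lift (F.*-identityʳ x))
      ; distrib    = (λ x y z → lift (F.distribˡ x y z)) , (λ x y z → lift (F.distribʳ x y z)) }
    ; *-comm = λ x y → lift (F.*-comm x y) }
  isCommutativeRing (suc n) = record
    { isRing = record
      { +-isAbelianGroup = record
        { isGroup = record
          { isMonoid = record
            { isSemigroup = record
              { isMagma = record
                { isEquivalence = record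
                  { refl  = λ {x} → ≋-refl x
                  ; sym   = ≋-sym
                  ; trans = ≋-trans }
                ; ∙-cong = ⊕-cong }
              ; assoc = ⊕-assoc }
            ; identity = ≋-refl , (λ x → zeros-right x {[]} []) }
          ; inverse = (λ x → zeros-eq (neg-invˡ x) []) , (λ x → zeros-eq (neg-invʳ x) [])
          ; ⁻¹-cong = neg-cong }
        ; comm = ⊕-comm }
      ; *-cong     = λ {x} {y} {u} e₁ e₂ → ≋-trans (⊗-congˡ u e₁) (⊗-congʳ y e₂)
      ; *-assoc    = ⊗-assoc
      ; *-identity = ⊗-identityˡ , (λ x → ≋-trans (⊗-comm x _) (⊗-identityˡ x))
      ; distrib    = distˡ , (λ x y z → distʳ y z x) }
    ; *-comm = ⊗-comm }
    where open CoefficientLists n (isCommutativeRing n)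

  commutativeRing : ℕ → CommutativeRing c (c ⊔ ℓ)
  commutativeRing n = record { isCommutativeRing = isCommutativeRing n }

  constant : ∀ n → F.Carrier → Poly n
  constant zero    a = a
  constant (suc n) a = constant n a ∷ []

  constant-isRingHomomorphism : ∀ n →
    IsRingHomomorphism F.rawRing (CommutativeRing.rawRing (commutativeRing n)) (constant n)
  constant-isRingHomomorphism n = record
    { isSemiringHomomorphism = record
      { isNearSemiringHomomorphism = record
        { +-isMonoidHomomorphism = record
          { isMagmaHomomorphism = record
            { isRelHomomorphism = record { cong = cong n }
            ; homo = +-homo n }
          ; ε-homo = 0#-homo n }
        ; *-homo = *-homo n }
      ; 1#-homo = 1#-homo n }
    ; -‿homo = -‿homo n }
    where
    cong : ∀ n {a b} → a F.≈ b → Eq n (constant n a) (constant n b)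
    cong zero    e = lift e
    cong (suc n) e = cong n e , []

    +-homo : ∀ n a b → Eq n (constant n (a F.+ b)) (addP n (constant n a) (constant n b))
    +-homo zero    a b = lift F.refl
    +-homo (suc n) a b = +-homo n a b , []

    *-homo : ∀ n a b → Eq n (constant n (a F.* b)) (mulP n (constant n a) (constant n b))
    *-homo zero    a b = lift F.refl
    *-homo (suc n) a b = trans (*-homo n a b) (sym (+-identityʳ _)) , []
      where open IsCommutativeRing (isCommutativeRing n)

    0#-homo : ∀ n → Eq n (constant n F.0#) (zeroP n)
    0#-homo zero    = lift F.refl
    0#-homo (suc n) = ≈0⇒isZero n _ (0#-homo n) ∷ []

    1#-homo : ∀ n → Eq n (constant n F.1#) (oneP n)
    1#-homo zero    = lift F.refl
    1#-homo (suc n) = 1#-homo n , []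

    -‿homo : ∀ n a → Eq n (constant n (F.- a)) (negP n (constant n a))
    -‿homo zero    a = lift F.refl
    -‿homo (suc n) a = -‿homo n a , []

-- The theorem: of the k+1 distinct elements of F the last k serve as the
-- nodes, and F[x₁,…,xₙ] is an F-algebra via the constant polynomials.
proposition3p1 : ∀ {c ℓ} (F : Field c ℓ) (k : ℕ) → 2 ≤ k →
    MoreThan (Field.rawRing F) k →
    ¬ (Field._≈_ F (mult1 (Field.rawRing F) k) (Field.0# F)) →
    (∀ (a : Field.Carrier F) → InW (Field.rawRing F) k a) →
    ∀ (n : ℕ) → 1 ≤ n →
    ∀ (P : Polynomials.Poly F n) → InW (Polynomials.PolyRing F n) k P
proposition3p1 F zero    ()
proposition3p1 F (suc k) _ (_ ∷ a₀ ∷ as , length≡k+1 , _ ∷ distinct) k≉0 F-powers n _ =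
  FieldAlgebras.every-element-is-a-sum-of-powers F (commutativeRing n) (constant n)
    (constant-isRingHomomorphism n) (suc k) a₀ as distinct (suc-injective length≡k+1) k≉0 F-powers
  where open PolynomialRing F
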